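{- Let $G$ be a non-regular graph on $n$ vertices, let $u,v$ be vertices of $G$ with $d_G(u)<d_G(v)$, let $R=V(G)\setminus\{u,v\}$, and define $X=N(u)\setminus N[v]$, $Y=N(v)\setminus N[u]$, $W=N(u)\cap N(v)$, and $Z=R\setminus(X\cup Y\cup W)$. Let $2\le k\le n-2$. If $k-1\le |X|+|W|+|Z|$, then $F_k(G)$ is not regular.
   Context: All graphs are finite and simple. $N(w)$ is the set of neighbours of $w$ in $G$, $N[w]=N(w)\cup\{w\}$, and $d_G(w)=|N(w)|$. For a graph $G=(V,E)$ on $n$ vertices and $1\le k<n$, the $k$-token graph $F_k(G)$ has as vertices the $k$-element subsets of $V$, with $A,B$ adjacent whenever $A\triangle B=\{a,b\}$ for some edge $ab$ of $G$. -}

module Defs where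

open import Data.Bool using (Bool; true; false; _∧_; _∨_; _xor_; not; T)
open import Data.Nat using (ℕ; zero; suc; _≡ᵇ_)
open import Data.Fin using (Fin; _≟_)
open import Data.List using (List; []; _∷_; map; _++_; length; filterᵇ; allFin)
open import Data.Bool.ListAction using (any; all)
open import Data.Vec using (Vec; []; _∷_; lookup)
open import Data.Product using (∃; Σ; _,_)
open import Relation.Binary.PropositionalEquality using (_≡_)
open import Relation.Nullary using (¬_)
open import Relation.Nullary.Decidable using (⌊_⌋)

record Graph (n : ℕ) : Set where
  field
    adj    : Fin n → Fin n → Bool
    sym    : ∀ a b → adj a b ≡ adj b a
    irrefl : ∀ a → adj a a ≡ false
open Graph public

countᵇ : ∀ {n} → (Fin n → Bool) → ℕ
countᵇ {n} p = length (filterᵇ p (allFin n))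

deg : ∀ {n} → Graph n → Fin n → ℕ
deg G w = countᵇ (adj G w)

IsRegular : ∀ {n} → Graph n → Set
IsRegular {n} G = ∃ λ r → ∀ (w : Fin n) → deg G w ≡ r

Subset : ℕ → Set
Subset n = Vec Bool n

allSubsets : ∀ n → List (Subset n)
allSubsets zero    = [] ∷ []
allSubsets (suc n) = map (true ∷_) (allSubsets n) ++ map (false ∷_) (allSubsets n)

card : ∀ {n} → Subset n → ℕ
card []            = zero
card (true  ∷ xs)  = suc (card xs)
card (false ∷ xs)  = card xs

_==_ : ∀ {n} → Fin n → Fin n → Bool
i == j = ⌊ i ≟ j ⌋

_⇔ᵇ_ : Bool → Bool → Bool
true  ⇔ᵇ y = y
false ⇔ᵇ y = not y

-- Adjacency in the token graph: A △ B = {a, b} for some edge ab of G.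
tokenAdj : ∀ {n} → Graph n → Subset n → Subset n → Bool
tokenAdj {n} G A B =
  any (λ a → any (λ b →
        adj G a b ∧
        all (λ i → (lookup A i xor lookup B i) ⇔ᵇ (i == a ∨ i == b)) (allFin n))
      (allFin n)) (allFin n)

tokenDeg : ∀ {n} → Graph n → ℕ → Subset n → ℕ
tokenDeg {n} G k A =
  length (filterᵇ (λ B → (card B ≡ᵇ k) ∧ tokenAdj G A B) (allSubsets n))

TokenRegular : ∀ {n} → Graph n → ℕ → Set
TokenRegular {n} G k = ∃ λ r → ∀ (A : Subset n) → card A ≡ k → tokenDeg G k A ≡ r

sizeX : ∀ {n} → Graph n → Fin n → Fin n → ℕ
sizeX G u v = countᵇ (λ w → adj G u w ∧ not (adj G v w) ∧ not (w == v))

sizeW : ∀ {n} → Graph n → Fin n → Fin n → ℕ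
sizeW G u v = countᵇ (λ w → adj G u w ∧ adj G v w)

sizeZ : ∀ {n} → Graph n → Fin n → Fin n → ℕ
sizeZ G u v = countᵇ (λ w →
  not (w == u) ∧ not (w == v)
  ∧ not (adj G u w ∧ not (adj G v w) ∧ not (w == v))
  ∧ not (adj G v w ∧ not (adj G u w) ∧ not (w == u))
  ∧ not (adj G u w ∧ adj G v w))

-- The neighbours of a k-set A in F_k(G) are the sets A − a + b with a ∈ A, b ∉ A and ab an
-- edge, each obtained from exactly one such pair, so the degree of A in F_k(G) is the number
-- ∂A of edges of G leaving A. Adding a vertex w ∉ S to S gives
-- ∂(S ∪ {w}) = ∂S + d(w) − 2|N(w) ∩ S|. The hypothesis lets us choose S ⊆ X ∪ W ∪ Z = R ∖ Y
-- with |S| = k − 1; a vertex of S adjacent to v is then adjacent to u, so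
-- |N(v) ∩ S| ≤ |N(u) ∩ S|, and together with d(u) < d(v) this makes the k-sets S ∪ {u} and
-- S ∪ {v} have different degrees in F_k(G).
module Submission where

open import Data.Bool using (Bool; true; false; _∧_; _∨_; _xor_; not)
open import Data.Bool.ListAction using (any; all)
open import Data.Bool.Properties as Bool using (T-≡; xor-assoc; xor-same)
open import Data.Empty using (⊥; ⊥-elim)
open import Data.Fin as Fin using (Fin; _≟_)
open import Data.Fin.Properties using (punchInᵢ≢i)
open import Data.List using (List; []; _∷_; _++_; map; length; filterᵇ; tabulate; allFin)
open import Data.List.Membership.Propositional using (lose)
open import Data.List.Membership.Propositional.Properties using (∈-allFin)
open import Data.List.Properties using (map-++; map-∘; map-cong)
open import Data.List.Relation.Unary.All as All using ()
open import Data.List.Relation.Unary.All.Properties using (all⁺; all⁻)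
open import Data.List.Relation.Unary.Any using (satisfied)
open import Data.List.Relation.Unary.Any.Properties using (any⁺; any⁻)
open import Data.Nat using (ℕ; zero; suc; _+_; _∸_; _≡ᵇ_; _≤_; _<_; z≤n; s≤s; s≤s⁻¹)
open import Data.Nat.ListAction using () renaming (sum to sumˡ)
open import Data.Nat.ListAction.Properties using () renaming (sum-++ to sumˡ-++)
open import Data.Nat.Properties
  using ( +-0-commutativeMonoid; +-identityʳ; +-comm; +-assoc; +-cancelˡ-≡; +-cancelʳ-≡
        ; +-mono-≤; +-monoʳ-≤; +-monoʳ-<; +-cancelʳ-<; ≤-trans; <-irrefl; ≡ᵇ⇒≡; ≡⇒≡ᵇ
        ; module ≤-Reasoning )
open import Data.Product using (_×_; _,_; proj₁; proj₂; ∃; ∃₂)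
open import Data.Sum using (_⊎_; inj₁; inj₂)
open import Data.Vec as Vec using ([]; _∷_; lookup)
open import Data.Vec.Properties using (≡-dec; lookup∘tabulate; tabulate∘lookup; tabulate-cong)
open import Function using (_∘_; id)
open import Function.Bundles using (Equivalence)
open import Relation.Binary.PropositionalEquality
open import Relation.Nullary using (Dec; does; ¬_)
open import Relation.Nullary.Decidable using (isYes≗does; dec-true; dec-false; toWitness)

open import Algebra.Properties.CommutativeMonoid.Sum +-0-commutativeMonoid
  using (sum; sum-syntax; ∑-distrib-+; ∑-comm; sum-cong-≗; sum-replicate-zero; sum-remove)
open import Defs renaming (sym to adj-sym)

𝟙 : Bool → ℕ
𝟙 true  = 1
𝟙 false = 0

𝟙-false : ∀ {x} → (x ≡ true → ⊥) → 𝟙 x ≡ 0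
𝟙-false {true}  x≢true = ⊥-elim (x≢true refl)
𝟙-false {false} _      = refl

does-sound : ∀ {P : Set} {p? : Dec P} → does p? ≡ true → P
does-sound {p? = p?} yes = toWitness (Equivalence.from T-≡ (trans (isYes≗does p?) yes))

==-refl : ∀ {n} (i : Fin n) → (i == i) ≡ true
==-refl i = trans (isYes≗does (i ≟ i)) (dec-true (i ≟ i) refl)

==-≢ : ∀ {n} {i j : Fin n} → i ≢ j → (i == j) ≡ false
==-≢ {i = i} {j} i≢j = trans (isYes≗does (i ≟ j)) (dec-false (i ≟ j) i≢j)

==⇒≡ : ∀ {n} {i j : Fin n} → (i == j) ≡ true → i ≡ j
==⇒≡ i==j = toWitness (Equivalence.from T-≡ i==j)

∧-split : ∀ {x y} → x ∧ y ≡ true → x ≡ true × y ≡ true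
∧-split {true} {true} _ = refl , refl

⇔ᵇ-≡ : ∀ {x y} → (x ⇔ᵇ y) ≡ true → x ≡ y
⇔ᵇ-≡ {true}  {true}  _ = refl
⇔ᵇ-≡ {false} {false} _ = refl

⇔ᵇ-refl : ∀ x → (x ⇔ᵇ x) ≡ true
⇔ᵇ-refl true  = refl
⇔ᵇ-refl false = refl

xor-cancelˡ : ∀ x y → x xor (x xor y) ≡ y
xor-cancelˡ x y = trans (sym (xor-assoc x x y)) (cong (_xor y) (xor-same x))

xor-solve : ∀ x {y z} → x xor y ≡ z → y ≡ x xor z
xor-solve x {y} eq = trans (sym (xor-cancelˡ x y)) (cong (x xor_) eq)

xor-injectiveʳ : ∀ x {y z} → x xor y ≡ x xor z → y ≡ z
xor-injectiveʳ x {z = z} eq = trans (xor-solve x eq) (xor-cancelˡ x z)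

pair-member : ∀ {n} {i a b : Fin n} → (i == a) ∨ (i == b) ≡ true → i ≡ a ⊎ i ≡ b
pair-member {i = i} {a} i∈ab with i == a in i==a
... | true  = inj₁ (==⇒≡ i==a)
... | false = inj₂ (==⇒≡ i∈ab)

pair-disjoint : ∀ {n} {a b : Fin n} → a ≢ b → ∀ i → (i == a) ∧ (i == b) ≡ false
pair-disjoint {a = a} a≢b i with i == a in i==a
... | false = refl
... | true  = ==-≢ (λ i≡b → a≢b (trans (sym (==⇒≡ i==a)) i≡b))

any-allFin⁺ : ∀ {n} (p : Fin n → Bool) i → p i ≡ true → any p (allFin n) ≡ true
any-allFin⁺ p i pi = Equivalence.to T-≡ (any⁺ p (lose (∈-allFin i) (Equivalence.from T-≡ pi)))

any-allFin⁻ : ∀ {n} (p : Fin n → Bool) → any p (allFin n) ≡ true → ∃ λ i → p i ≡ true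
any-allFin⁻ {n} p any-p with i , pi ← satisfied (any⁻ p (allFin n) (Equivalence.from T-≡ any-p)) =
  i , Equivalence.to T-≡ pi

all-allFin⁺ : ∀ {n} (p : Fin n → Bool) → (∀ i → p i ≡ true) → all p (allFin n) ≡ true
all-allFin⁺ {n} p all-p =
  Equivalence.to T-≡ (all⁻ p {allFin n} (All.tabulate (λ {i} _ → Equivalence.from T-≡ (all-p i))))

all-allFin⁻ : ∀ {n} (p : Fin n → Bool) → all p (allFin n) ≡ true → ∀ i → p i ≡ true
all-allFin⁻ {n} p all-p i =
  Equivalence.to T-≡ (All.lookup (all⁺ p (allFin n) (Equivalence.from T-≡ all-p)) (∈-allFin i))

∑-zero : ∀ {n} {f : Fin n → ℕ} → (∀ i → f i ≡ 0) → ∑[ i < n ] f i ≡ 0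
∑-zero {n} f≗0 = trans (sum-cong-≗ f≗0) (sum-replicate-zero n)

∑-pointSupport : ∀ {n} (f : Fin n → ℕ) j → (∀ i → i ≢ j → f i ≡ 0) → ∑[ i < n ] f i ≡ f j
∑-pointSupport {suc n} f j off-j =
  trans (sum-remove {i = j} f)
        (trans (cong (f j +_) (∑-zero (λ k → off-j _ (punchInᵢ≢i j k)))) (+-identityʳ (f j)))

∑-mono-≤ : ∀ {n} {f g : Fin n → ℕ} → (∀ i → f i ≤ g i) → ∑[ i < n ] f i ≤ ∑[ i < n ] g i
∑-mono-≤ {zero}  f≤g = z≤n
∑-mono-≤ {suc n} f≤g = +-mono-≤ (f≤g Fin.zero) (∑-mono-≤ (f≤g ∘ Fin.suc))

∑∑-distrib-+ : ∀ {n} (f g : Fin n → Fin n → ℕ) →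
  ∑[ a < n ] ∑[ b < n ] (f a b + g a b) ≡ ∑[ a < n ] ∑[ b < n ] f a b + ∑[ a < n ] ∑[ b < n ] g a b
∑∑-distrib-+ {n} f g =
  trans (sum-cong-≗ (λ a → ∑-distrib-+ (f a) (g a))) (∑-distrib-+ (λ a → ∑[ b < n ] f a b) _)

∑-𝟙-at : ∀ {n} (p : Fin n → Bool) j → ∑[ i < n ] 𝟙 ((i == j) ∧ p i) ≡ 𝟙 (p j)
∑-𝟙-at p j = trans (∑-pointSupport _ j (λ i i≢j → cong (λ b → 𝟙 (b ∧ p i)) (==-≢ i≢j)))
                   (cong (λ b → 𝟙 (b ∧ p j)) (==-refl j))

∑-𝟙-pair : ∀ {n} (f : Fin n → ℕ) (p : Fin n → Bool) a b →
  ∑[ i < n ] (f i + (𝟙 ((i == a) ∧ p i) + 𝟙 ((i == b) ∧ p i))) ≡ ∑[ i < n ] f i + (𝟙 (p a) + 𝟙 (p b))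
∑-𝟙-pair {n} f p a b = begin
  ∑[ i < n ] (f i + (𝟙 ((i == a) ∧ p i) + 𝟙 ((i == b) ∧ p i)))
    ≡⟨ ∑-distrib-+ f _ ⟩
  sum f + ∑[ i < n ] (𝟙 ((i == a) ∧ p i) + 𝟙 ((i == b) ∧ p i))
    ≡⟨ cong (sum f +_) (∑-distrib-+ (λ i → 𝟙 ((i == a) ∧ p i)) (λ i → 𝟙 ((i == b) ∧ p i))) ⟩
  sum f + (∑[ i < n ] 𝟙 ((i == a) ∧ p i) + ∑[ i < n ] 𝟙 ((i == b) ∧ p i))
    ≡⟨ cong (sum f +_) (cong₂ _+_ (∑-𝟙-at p a) (∑-𝟙-at p b)) ⟩
  sum f + (𝟙 (p a) + 𝟙 (p b)) ∎
  where open ≡-Reasoning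

∑∑-𝟙-none : ∀ {n} (Q : Fin n → Fin n → Bool) → (∀ a b → Q a b ≡ true → ⊥) →
  ∑[ a < n ] ∑[ b < n ] 𝟙 (Q a b) ≡ 0
∑∑-𝟙-none Q none = ∑-zero (λ a → ∑-zero (λ b → 𝟙-false (none a b)))

∑∑-𝟙-unique : ∀ {n} (Q : Fin n → Fin n → Bool) {a₀ b₀} → Q a₀ b₀ ≡ true →
  (∀ a b → Q a b ≡ true → a ≡ a₀ × b ≡ b₀) → ∑[ a < n ] ∑[ b < n ] 𝟙 (Q a b) ≡ 1
∑∑-𝟙-unique Q {a₀} {b₀} Q₀ unique =
  trans (∑-pointSupport _ a₀ (λ a a≢a₀ → ∑-zero (λ b → 𝟙-false (a≢a₀ ∘ proj₁ ∘ unique a b))))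
        (trans (∑-pointSupport _ b₀ (λ b b≢b₀ → 𝟙-false (b≢b₀ ∘ proj₂ ∘ unique a₀ b)))
               (cong 𝟙 Q₀))

length-filterᵇ-tabulate : ∀ {A : Set} {n} (p : A → Bool) (g : Fin n → A) →
  length (filterᵇ p (tabulate g)) ≡ ∑[ i < n ] 𝟙 (p (g i))
length-filterᵇ-tabulate {n = zero}  p g = refl
length-filterᵇ-tabulate {n = suc n} p g with p (g Fin.zero)
... | true  = cong suc (length-filterᵇ-tabulate p (g ∘ Fin.suc))
... | false = length-filterᵇ-tabulate p (g ∘ Fin.suc)

countᵇ≡∑ : ∀ {n} (p : Fin n → Bool) → countᵇ p ≡ ∑[ i < n ] 𝟙 (p i)
countᵇ≡∑ p = length-filterᵇ-tabulate p id

card≡∑ : ∀ {n} (A : Subset n) → card A ≡ ∑[ i < n ] 𝟙 (lookup A i)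
card≡∑ []          = refl
card≡∑ (true  ∷ A) = cong suc (card≡∑ A)
card≡∑ (false ∷ A) = card≡∑ A

length-filterᵇ : ∀ {A : Set} (p : A → Bool) xs → length (filterᵇ p xs) ≡ sumˡ (map (𝟙 ∘ p) xs)
length-filterᵇ p []       = refl
length-filterᵇ p (x ∷ xs) with p x
... | true  = cong suc (length-filterᵇ p xs)
... | false = length-filterᵇ p xs

sumˡ-map-0 : ∀ {A : Set} (xs : List A) → sumˡ (map (λ _ → 0) xs) ≡ 0
sumˡ-map-0 []       = refl
sumˡ-map-0 (_ ∷ xs) = sumˡ-map-0 xs

sumˡ-map-∑ : ∀ {A : Set} {n} (f : A → Fin n → ℕ) xs →
  sumˡ (map (λ x → ∑[ i < n ] f x i) xs) ≡ ∑[ i < n ] sumˡ (map (λ x → f x i) xs)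
sumˡ-map-∑ {n = n} f []       = sym (sum-replicate-zero n)
sumˡ-map-∑         f (x ∷ xs) =
  trans (cong (sum (f x) +_) (sumˡ-map-∑ f xs)) (sym (∑-distrib-+ (f x) _))

_≟ˢ_ : ∀ {n} (A B : Subset n) → Dec (A ≡ B)
_≟ˢ_ = ≡-dec Bool._≟_

allSubsets-unique : ∀ n (C : Subset n) → sumˡ (map (λ B → 𝟙 (does (B ≟ˢ C))) (allSubsets n)) ≡ 1
allSubsets-unique zero    []      = refl
allSubsets-unique (suc n) (c ∷ C) = begin
  sumˡ (map χ (map (true ∷_) Bs ++ map (false ∷_) Bs))
    ≡⟨ cong sumˡ (map-++ χ (map (true ∷_) Bs) _) ⟩
  sumˡ (map χ (map (true ∷_) Bs) ++ map χ (map (false ∷_) Bs))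
    ≡⟨ sumˡ-++ (map χ (map (true ∷_) Bs)) _ ⟩
  sumˡ (map χ (map (true ∷_) Bs)) + sumˡ (map χ (map (false ∷_) Bs))
    ≡⟨ cong₂ (λ xs ys → sumˡ xs + sumˡ ys) (sym (map-∘ Bs)) (sym (map-∘ Bs)) ⟩
  sumˡ (map (χ ∘ (true ∷_)) Bs) + sumˡ (map (χ ∘ (false ∷_)) Bs)
    ≡⟨ split c ⟩
  1 ∎
  where
  open ≡-Reasoning
  Bs : List (Subset n)
  Bs = allSubsets n
  χ : Subset (suc n) → ℕ
  χ B = 𝟙 (does (B ≟ˢ (c ∷ C)))
  split : ∀ c → sumˡ (map (λ B → 𝟙 (does ((true ∷ B) ≟ˢ (c ∷ C)))) Bs)
              + sumˡ (map (λ B → 𝟙 (does ((false ∷ B) ≟ˢ (c ∷ C)))) Bs) ≡ 1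
  split true  = cong₂ _+_ (allSubsets-unique n C) (sumˡ-map-0 Bs)
  split false = cong₂ _+_ (sumˡ-map-0 Bs) (allSubsets-unique n C)

choose-subset : ∀ {n} (q : Fin n → Bool) m → m ≤ ∑[ i < n ] 𝟙 (q i) →
  ∃ λ (S : Subset n) → card S ≡ m × (∀ i → lookup S i ≡ true → q i ≡ true)
choose-subset {zero}  q zero    _ = [] , refl , λ ()
choose-subset {suc n} q zero    _ with S , card-S , S⊆q ← choose-subset (q ∘ Fin.suc) zero z≤n =
  false ∷ S , card-S , λ { (Fin.suc i) → S⊆q i }
choose-subset {suc n} q (suc m) m<∑ with q Fin.zero in q₀
... | true  with S , card-S , S⊆q ← choose-subset (q ∘ Fin.suc) m (s≤s⁻¹ m<∑) =
  true ∷ S , cong suc card-S , λ { Fin.zero _ → q₀ ; (Fin.suc i) → S⊆q i }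
... | false with S , card-S , S⊆q ← choose-subset (q ∘ Fin.suc) (suc m) m<∑ =
  false ∷ S , card-S , λ { (Fin.suc i) → S⊆q i }

⊆-∉ : ∀ {n} (S : Subset n) {q : Fin n → Bool} → (∀ i → lookup S i ≡ true → q i ≡ true) →
  ∀ x → q x ≡ false → lookup S x ≡ false
⊆-∉ S S⊆q x x∉q with lookup S x in x∈S
... | false = refl
... | true  with () ← trans (sym (S⊆q x x∈S)) x∉q

toggle : ∀ {n} → Subset n → Fin n → Fin n → Subset n
toggle A a b = Vec.tabulate (λ i → lookup A i xor ((i == a) ∨ (i == b)))

lookup-toggle : ∀ {n} (A : Subset n) a b i → lookup (toggle A a b) i ≡ lookup A i xor ((i == a) ∨ (i == b))
lookup-toggle A a b = lookup∘tabulate _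

toggle-𝟙 : ∀ x p q → p ∧ q ≡ false →
  𝟙 (x xor (p ∨ q)) + (𝟙 (p ∧ x) + 𝟙 (q ∧ x)) ≡ 𝟙 x + (𝟙 (p ∧ not x) + 𝟙 (q ∧ not x))
toggle-𝟙 x     true  true  ()
toggle-𝟙 true  true  false _ = refl
toggle-𝟙 true  false true  _ = refl
toggle-𝟙 true  false false _ = refl
toggle-𝟙 false true  false _ = refl
toggle-𝟙 false false true  _ = refl
toggle-𝟙 false false false _ = refl

card-toggle : ∀ {n} (A : Subset n) {a b} → a ≢ b →
  card (toggle A a b) + (𝟙 (lookup A a) + 𝟙 (lookup A b))
    ≡ card A + (𝟙 (not (lookup A a)) + 𝟙 (not (lookup A b)))
card-toggle {n} A {a} {b} a≢b = begin
  card (toggle A a b) + (𝟙 (lookup A a) + 𝟙 (lookup A b))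
    ≡⟨ cong (_+ (𝟙 (lookup A a) + 𝟙 (lookup A b))) (card≡∑ (toggle A a b)) ⟩
  ∑[ i < n ] 𝟙 (lookup (toggle A a b) i) + (𝟙 (lookup A a) + 𝟙 (lookup A b))
    ≡⟨ ∑-𝟙-pair _ (lookup A) a b ⟨
  ∑[ i < n ] (𝟙 (lookup (toggle A a b) i) + (𝟙 ((i == a) ∧ lookup A i) + 𝟙 ((i == b) ∧ lookup A i)))
    ≡⟨ sum-cong-≗ pointwise ⟩
  ∑[ i < n ] (𝟙 (lookup A i) + (𝟙 ((i == a) ∧ not (lookup A i)) + 𝟙 ((i == b) ∧ not (lookup A i))))
    ≡⟨ ∑-𝟙-pair _ (not ∘ lookup A) a b ⟩
  ∑[ i < n ] 𝟙 (lookup A i) + (𝟙 (not (lookup A a)) + 𝟙 (not (lookup A b)))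
    ≡⟨ cong (_+ (𝟙 (not (lookup A a)) + 𝟙 (not (lookup A b)))) (card≡∑ A) ⟨
  card A + (𝟙 (not (lookup A a)) + 𝟙 (not (lookup A b))) ∎
  where
  open ≡-Reasoning
  pointwise : ∀ i → 𝟙 (lookup (toggle A a b) i) + (𝟙 ((i == a) ∧ lookup A i) + 𝟙 ((i == b) ∧ lookup A i))
                  ≡ 𝟙 (lookup A i) + (𝟙 ((i == a) ∧ not (lookup A i)) + 𝟙 ((i == b) ∧ not (lookup A i)))
  pointwise i rewrite lookup-toggle A a b i = toggle-𝟙 (lookup A i) (i == a) (i == b) (pair-disjoint a≢b i)

toggle-injective : ∀ {n} (A : Subset n) {a b a′ b′} →
  lookup A a ≡ true → lookup A b ≡ false → lookup A a′ ≡ true → lookup A b′ ≡ false →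
  toggle A a b ≡ toggle A a′ b′ → a ≡ a′ × b ≡ b′
toggle-injective A {a} {b} {a′} {b′} a∈A b∉A a′∈A b′∉A eq = a≡a′ , b≡b′
  where
  same-pair : ∀ i → (i == a) ∨ (i == b) ≡ (i == a′) ∨ (i == b′)
  same-pair i = xor-injectiveʳ (lookup A i)
    (trans (sym (lookup-toggle A a b i)) (trans (cong (λ X → lookup X i) eq) (lookup-toggle A a′ b′ i)))
  ∈∉⇒≢ : ∀ {x y} → lookup A x ≡ true → lookup A y ≡ false → x ≢ y
  ∈∉⇒≢ x∈A y∉A refl with () ← trans (sym x∈A) y∉A
  a≡a′ : a ≡ a′
  a≡a′ with pair-member (trans (sym (same-pair a)) (cong (_∨ (a == b)) (==-refl a)))
  ... | inj₁ a≡a′ = a≡a′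
  ... | inj₂ a≡b′ = ⊥-elim (∈∉⇒≢ a∈A b′∉A a≡b′)
  b≡b′ : b ≡ b′
  b≡b′ with pair-member (trans (sym (same-pair b)) (trans (cong ((b == a) ∨_) (==-refl b)) (Bool.∨-zeroʳ _)))
  ... | inj₁ b≡a′ = ⊥-elim (∈∉⇒≢ a′∈A b∉A (sym b≡a′))
  ... | inj₂ b≡b′ = b≡b′

insert : ∀ {n} → Subset n → Fin n → Subset n
insert T w = Vec.tabulate (λ i → (i == w) ∨ lookup T i)

lookup-insert : ∀ {n} (T : Subset n) w i → lookup (insert T w) i ≡ (i == w) ∨ lookup T i
lookup-insert T w = lookup∘tabulate _

𝟙-∨ : ∀ p x → 𝟙 (p ∨ x) ≡ 𝟙 x + 𝟙 (p ∧ not x)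
𝟙-∨ true  true  = refl
𝟙-∨ true  false = refl
𝟙-∨ false x     = sym (+-identityʳ (𝟙 x))

card-insert : ∀ {n} (T : Subset n) {w} → lookup T w ≡ false → card (insert T w) ≡ suc (card T)
card-insert {n} T {w} w∉T = begin
  card (insert T w)
    ≡⟨ card≡∑ (insert T w) ⟩
  ∑[ i < n ] 𝟙 (lookup (insert T w) i)
    ≡⟨ sum-cong-≗ (λ i → trans (cong 𝟙 (lookup-insert T w i)) (𝟙-∨ (i == w) (lookup T i))) ⟩
  ∑[ i < n ] (𝟙 (lookup T i) + 𝟙 ((i == w) ∧ not (lookup T i)))
    ≡⟨ ∑-distrib-+ (λ i → 𝟙 (lookup T i)) _ ⟩
  ∑[ i < n ] 𝟙 (lookup T i) + ∑[ i < n ] 𝟙 ((i == w) ∧ not (lookup T i))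
    ≡⟨ cong₂ _+_ (card≡∑ T) (sym (trans (∑-𝟙-at (not ∘ lookup T) w) (cong (𝟙 ∘ not) w∉T))) ⟨
  card T + 1
    ≡⟨ +-comm (card T) 1 ⟩
  suc (card T) ∎
  where open ≡-Reasoning

-- p, q say whether a, b is the inserted vertex w; x, y whether a, b lie in T; e whether ab is an edge.
insert-𝟙 : ∀ p q x y e → (p ≡ true → x ≡ false) → (q ≡ true → y ≡ false) → (p ≡ true → q ≡ true → e ≡ false) →
  𝟙 ((p ∨ x) ∧ not (q ∨ y) ∧ e) + 𝟙 (q ∧ x ∧ e) ≡ 𝟙 (x ∧ not y ∧ e) + 𝟙 (p ∧ not y ∧ e)
insert-𝟙 false false x     y e _   _   _    = refl
insert-𝟙 true  false x     y e p⇒¬x _   _    rewrite p⇒¬x refl = +-identityʳ _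
insert-𝟙 false true  false y e _   _   _    = refl
insert-𝟙 false true  true  y e _   q⇒¬y _    rewrite q⇒¬y refl = sym (+-identityʳ (𝟙 e))
insert-𝟙 true  true  x     y e p⇒¬x q⇒¬y pq⇒¬e rewrite p⇒¬x refl | q⇒¬y refl | pq⇒¬e refl refl = refl

𝟙-split : ∀ x y → 𝟙 (not x ∧ y) + 𝟙 (x ∧ y) ≡ 𝟙 y
𝟙-split true  y = refl
𝟙-split false y = +-identityʳ (𝟙 y)

module _ {n : ℕ} (G : Graph n) where

  outEdge : Subset n → Fin n → Fin n → Bool
  outEdge A a b = lookup A a ∧ not (lookup A b) ∧ adj G a b

  ∂ : Subset n → ℕ
  ∂ A = ∑[ a < n ] ∑[ b < n ] 𝟙 (outEdge A a b)

  degIn degOut : Subset n → Fin n → ℕ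
  degIn  T w = ∑[ i < n ] 𝟙 (lookup T i ∧ adj G w i)
  degOut T w = ∑[ i < n ] 𝟙 (not (lookup T i) ∧ adj G w i)

  degOut+degIn : ∀ T w → degOut T w + degIn T w ≡ deg G w
  degOut+degIn T w = begin
    degOut T w + degIn T w
      ≡⟨ ∑-distrib-+ (λ i → 𝟙 (not (lookup T i) ∧ adj G w i)) _ ⟨
    ∑[ i < n ] (𝟙 (not (lookup T i) ∧ adj G w i) + 𝟙 (lookup T i ∧ adj G w i))
      ≡⟨ sum-cong-≗ (λ i → 𝟙-split (lookup T i) (adj G w i)) ⟩
    ∑[ i < n ] 𝟙 (adj G w i)
      ≡⟨ countᵇ≡∑ (adj G w) ⟨
    deg G w ∎
    where open ≡-Reasoning

  adj⇒≢ : ∀ {a b} → adj G a b ≡ true → a ≢ b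
  adj⇒≢ {a} ab refl with () ← trans (sym ab) (irrefl G a)

  outEdge⁻ : ∀ A a b → outEdge A a b ≡ true → lookup A a ≡ true × lookup A b ≡ false × adj G a b ≡ true
  outEdge⁻ A a b out with lookup A a | lookup A b | adj G a b | out
  ... | true | false | true | _ = refl , refl , refl

  tokenAdj-toggle : ∀ A {a b} → adj G a b ≡ true → tokenAdj G A (toggle A a b) ≡ true
  tokenAdj-toggle A {a} {b} ab =
    any-allFin⁺ _ a (any-allFin⁺ _ b (subst (λ e → e ∧ _ ≡ true) (sym ab) (all-allFin⁺ _ symmetric-difference)))
    where
    symmetric-difference : ∀ i → ((lookup A i xor lookup (toggle A a b) i) ⇔ᵇ ((i == a) ∨ (i == b))) ≡ true
    symmetric-difference i rewrite lookup-toggle A a b i | xor-cancelˡ (lookup A i) ((i == a) ∨ (i == b)) =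
      ⇔ᵇ-refl ((i == a) ∨ (i == b))

  tokenAdj⇒toggle : ∀ A B → tokenAdj G A B ≡ true → ∃₂ λ a b → adj G a b ≡ true × B ≡ toggle A a b
  tokenAdj⇒toggle A B A~B
    with a , ∃b ← any-allFin⁻ _ A~B
    with b , ab∧A△B≡ab ← any-allFin⁻ _ ∃b
    with ab , A△B≡ab ← ∧-split ab∧A△B≡ab =
    a , b , ab , trans (sym (tabulate∘lookup B)) (tabulate-cong (λ i →
      xor-solve (lookup A i) (⇔ᵇ-≡ (all-allFin⁻ _ A△B≡ab i))))

  card-toggle-outEdge : ∀ A {a b} → outEdge A a b ≡ true → card (toggle A a b) ≡ card A
  card-toggle-outEdge A {a} {b} out with a∈A , b∉A , ab ← outEdge⁻ A a b out =
    +-cancelʳ-≡ 1 _ _ (subst₂ (λ x y → card (toggle A a b) + (𝟙 x + 𝟙 y) ≡ card A + (𝟙 (not x) + 𝟙 (not y)))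
                              a∈A b∉A (card-toggle A (adj⇒≢ ab)))

  -- Moving a token along an edge preserves the size only if exactly one end carries a token.
  toggle-outEdge : ∀ A {a b} → adj G a b ≡ true → card (toggle A a b) ≡ card A →
    ∃₂ λ a′ b′ → outEdge A a′ b′ ≡ true × toggle A a b ≡ toggle A a′ b′
  toggle-outEdge A {a} {b} ab same-card
    with lookup A a in a∈A | lookup A b in b∈A | card-toggle A (adj⇒≢ ab)
  ... | true  | false | _ = a , b , outEdge-ab , refl
    where
    outEdge-ab : outEdge A a b ≡ true
    outEdge-ab rewrite a∈A | b∈A = ab
  ... | false | true  | _ =
    b , a , outEdge-ba , tabulate-cong (λ i → cong (lookup A i xor_) (Bool.∨-comm (i == a) (i == b)))
    where
    outEdge-ba : outEdge A b a ≡ true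
    outEdge-ba rewrite a∈A | b∈A = trans (adj-sym G b a) ab
  ... | true  | true  | counted
    with () ← +-cancelˡ-≡ (card A) 2 0 (trans (cong (_+ 2) (sym same-card)) counted)
  ... | false | false | counted
    with () ← +-cancelˡ-≡ (card A) 0 2 (trans (cong (_+ 0) (sym same-card)) counted)

  tokenNeighbour-𝟙 : ∀ A B →
    𝟙 ((card B ≡ᵇ card A) ∧ tokenAdj G A B) ≡ ∑[ a < n ] ∑[ b < n ] 𝟙 (outEdge A a b ∧ does (B ≟ˢ toggle A a b))
  tokenNeighbour-𝟙 A B with (card B ≡ᵇ card A) ∧ tokenAdj G A B in neighbour
  ... | true
    with same-card , A~B ← ∧-split neighbour
    with a , b , ab , refl ← tokenAdj⇒toggle A B A~B
    with a₀ , b₀ , out₀ , B≡ ← toggle-outEdge A ab (≡ᵇ⇒≡ _ _ (Equivalence.from T-≡ same-card)) =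
    sym (∑∑-𝟙-unique _ (cong₂ _∧_ out₀ (dec-true (toggle A a b ≟ˢ toggle A a₀ b₀) B≡)) unique)
    where
    unique : ∀ a′ b′ → outEdge A a′ b′ ∧ does (toggle A a b ≟ˢ toggle A a′ b′) ≡ true → a′ ≡ a₀ × b′ ≡ b₀
    unique a′ b′ Q
      with out , B≡′ ← ∧-split Q
      with a₀∈A , b₀∉A , _ ← outEdge⁻ A a₀ b₀ out₀
      with a′∈A , b′∉A , _ ← outEdge⁻ A a′ b′ out
      with a₀≡a′ , b₀≡b′ ← toggle-injective A a₀∈A b₀∉A a′∈A b′∉A
                             (trans (sym B≡) (does-sound {p? = toggle A a b ≟ˢ toggle A a′ b′} B≡′)) =
      sym a₀≡a′ , sym b₀≡b′
  ... | false = sym (∑∑-𝟙-none _ neighbour-of-toggle)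
    where
    neighbour-of-toggle : ∀ a b → outEdge A a b ∧ does (B ≟ˢ toggle A a b) ≡ true → ⊥
    neighbour-of-toggle a b Q
      with out , B≡ ← ∧-split Q
      with refl ← does-sound {p? = B ≟ˢ toggle A a b} B≡
      with _ , _ , ab ← outEdge⁻ A a b out
      with () ← trans (sym neighbour)
                  (cong₂ _∧_ (Equivalence.to T-≡ (≡⇒≡ᵇ _ _ (card-toggle-outEdge A out))) (tokenAdj-toggle A ab))

  tokenDeg≡∂ : ∀ {k} A → card A ≡ k → tokenDeg G k A ≡ ∂ A
  tokenDeg≡∂ A refl = begin
    tokenDeg G (card A) A
      ≡⟨ length-filterᵇ _ Bs ⟩
    sumˡ (map (λ B → 𝟙 ((card B ≡ᵇ card A) ∧ tokenAdj G A B)) Bs)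
      ≡⟨ cong sumˡ (map-cong (tokenNeighbour-𝟙 A) Bs) ⟩
    sumˡ (map (λ B → ∑[ a < n ] ∑[ b < n ] Q B a b) Bs)
      ≡⟨ sumˡ-map-∑ (λ B a → ∑[ b < n ] Q B a b) Bs ⟩
    ∑[ a < n ] sumˡ (map (λ B → ∑[ b < n ] Q B a b) Bs)
      ≡⟨ sum-cong-≗ (λ a → sumˡ-map-∑ (λ B b → Q B a b) Bs) ⟩
    ∑[ a < n ] ∑[ b < n ] sumˡ (map (λ B → Q B a b) Bs)
      ≡⟨ sum-cong-≗ (λ a → sum-cong-≗ (λ b → count-toggle a b)) ⟩
    ∂ A ∎
    where
    open ≡-Reasoning
    Bs : List (Subset n)
    Bs = allSubsets n
    Q : Subset n → Fin n → Fin n → ℕ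
    Q B a b = 𝟙 (outEdge A a b ∧ does (B ≟ˢ toggle A a b))
    count-toggle : ∀ a b → sumˡ (map (λ B → Q B a b) Bs) ≡ 𝟙 (outEdge A a b)
    count-toggle a b with outEdge A a b
    ... | true  = allSubsets-unique n (toggle A a b)
    ... | false = sumˡ-map-0 Bs

  ∂-insert : ∀ T {w} → lookup T w ≡ false → ∂ (insert T w) + (degIn T w + degIn T w) ≡ ∂ T + deg G w
  ∂-insert T {w} w∉T = begin
    ∂ (insert T w) + (degIn T w + degIn T w)
      ≡⟨ +-assoc (∂ (insert T w)) _ _ ⟨
    ∂ (insert T w) + degIn T w + degIn T w
      ≡⟨ cong (λ d → ∂ (insert T w) + d + degIn T w) ∑∑E₁≡degIn ⟨
    ∂ (insert T w) + ∑∑ E₁ + degIn T w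
      ≡⟨ cong (_+ degIn T w) (∑∑-distrib-+ _ E₁) ⟨
    ∑∑ (λ a b → 𝟙 (outEdge (insert T w) a b) + E₁ a b) + degIn T w
      ≡⟨ cong (_+ degIn T w) (sum-cong-≗ (λ a → sum-cong-≗ (pointwise a))) ⟩
    ∑∑ (λ a b → 𝟙 (outEdge T a b) + E₂ a b) + degIn T w
      ≡⟨ cong (_+ degIn T w) (∑∑-distrib-+ _ E₂) ⟩
    ∂ T + ∑∑ E₂ + degIn T w
      ≡⟨ +-assoc (∂ T) _ _ ⟩
    ∂ T + (∑∑ E₂ + degIn T w)
      ≡⟨ cong (λ d → ∂ T + (d + degIn T w)) ∑∑E₂≡degOut ⟩
    ∂ T + (degOut T w + degIn T w)
      ≡⟨ cong (∂ T +_) (degOut+degIn T w) ⟩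
    ∂ T + deg G w ∎
    where
    open ≡-Reasoning
    -- Inserting w turns the out-edges of T ending at w (E₁) into inner edges and adds the
    -- out-edges starting at w (E₂).
    ∑∑ : (Fin n → Fin n → ℕ) → ℕ
    ∑∑ f = ∑[ a < n ] ∑[ b < n ] f a b
    E₁ E₂ : Fin n → Fin n → ℕ
    E₁ a b = 𝟙 ((b == w) ∧ lookup T a ∧ adj G a b)
    E₂ a b = 𝟙 ((a == w) ∧ not (lookup T b) ∧ adj G a b)
    pointwise : ∀ a b → 𝟙 (outEdge (insert T w) a b) + E₁ a b ≡ 𝟙 (outEdge T a b) + E₂ a b
    pointwise a b rewrite lookup-insert T w a | lookup-insert T w b =
      insert-𝟙 (a == w) (b == w) (lookup T a) (lookup T b) (adj G a b)
        (λ a==w → trans (cong (lookup T) (==⇒≡ a==w)) w∉T)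
        (λ b==w → trans (cong (lookup T) (==⇒≡ b==w)) w∉T)
        (λ a==w b==w → trans (cong₂ (adj G) (==⇒≡ a==w) (==⇒≡ b==w)) (irrefl G w))
    ∑∑E₁≡degIn : ∑∑ E₁ ≡ degIn T w
    ∑∑E₁≡degIn = sum-cong-≗ (λ a →
      trans (∑-𝟙-at (λ b → lookup T a ∧ adj G a b) w) (cong (λ e → 𝟙 (lookup T a ∧ e)) (adj-sym G a w)))
    ∑∑E₂≡degOut : ∑∑ E₂ ≡ degOut T w
    ∑∑E₂≡degOut =
      trans (∑-comm E₂) (sum-cong-≗ (λ b → ∑-𝟙-at (λ a → not (lookup T b) ∧ adj G a b) w))

  ∂-insert-< : ∀ S {u v} → lookup S u ≡ false → lookup S v ≡ false →
    degIn S v ≤ degIn S u → deg G u < deg G v → ∂ (insert S u) < ∂ (insert S v)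
  ∂-insert-< S {u} {v} u∉S v∉S degIn≤ deg< = +-cancelʳ-< (degIn S v + degIn S v) _ _ (begin-strict
    ∂ (insert S u) + (degIn S v + degIn S v) ≤⟨ +-monoʳ-≤ (∂ (insert S u)) (+-mono-≤ degIn≤ degIn≤) ⟩
    ∂ (insert S u) + (degIn S u + degIn S u) ≡⟨ ∂-insert S u∉S ⟩
    ∂ S + deg G u                            <⟨ +-monoʳ-< (∂ S) deg< ⟩
    ∂ S + deg G v                            ≡⟨ ∂-insert S v∉S ⟨
    ∂ (insert S v) + (degIn S v + degIn S v) ∎)
    where open ≤-Reasoning

X∪W∪Z⊆R∖Y : ∀ u~w v~w w≡u w≡v → (w≡u ≡ true → u~w ≡ false) → (w≡v ≡ true → v~w ≡ false) →
  𝟙 (u~w ∧ not v~w ∧ not w≡v) + 𝟙 (u~w ∧ v~w)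
    + 𝟙 (not w≡u ∧ not w≡v ∧ not (u~w ∧ not v~w ∧ not w≡v) ∧ not (v~w ∧ not u~w ∧ not w≡u) ∧ not (u~w ∧ v~w))
  ≤ 𝟙 (not w≡u ∧ not w≡v ∧ not (v~w ∧ not u~w))
X∪W∪Z⊆R∖Y u~w   v~w   true  w≡v   ¬u~w _    rewrite ¬u~w refl = z≤n
X∪W∪Z⊆R∖Y true  v~w   false true  _    ¬v~w rewrite ¬v~w refl = z≤n
X∪W∪Z⊆R∖Y false v~w   false true  _    _    = z≤n
X∪W∪Z⊆R∖Y true  true  false false _    _    = s≤s z≤n
X∪W∪Z⊆R∖Y true  false false false _    _    = s≤s z≤n
X∪W∪Z⊆R∖Y false true  false false _    _    = z≤n
X∪W∪Z⊆R∖Y false false false false _    _    = s≤s z≤n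

module _ {n : ℕ} (G : Graph n) (u v : Fin n) where

  R∖Y : Fin n → Bool
  R∖Y w = not (w == u) ∧ not (w == v) ∧ not (adj G v w ∧ not (adj G u w))

  |X|+|W|+|Z|≤|R∖Y| : sizeX G u v + sizeW G u v + sizeZ G u v ≤ ∑[ w < n ] 𝟙 (R∖Y w)
  |X|+|W|+|Z|≤|R∖Y| = begin
    sizeX G u v + sizeW G u v + sizeZ G u v
      ≡⟨ cong₂ _+_ (cong₂ _+_ (countᵇ≡∑ inX) (countᵇ≡∑ inW)) (countᵇ≡∑ inZ) ⟩
    ∑[ w < n ] 𝟙 (inX w) + ∑[ w < n ] 𝟙 (inW w) + ∑[ w < n ] 𝟙 (inZ w)
      ≡⟨ cong (_+ ∑[ w < n ] 𝟙 (inZ w)) (∑-distrib-+ (𝟙 ∘ inX) (𝟙 ∘ inW)) ⟨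
    ∑[ w < n ] (𝟙 (inX w) + 𝟙 (inW w)) + ∑[ w < n ] 𝟙 (inZ w)
      ≡⟨ ∑-distrib-+ (λ w → 𝟙 (inX w) + 𝟙 (inW w)) (𝟙 ∘ inZ) ⟨
    ∑[ w < n ] (𝟙 (inX w) + 𝟙 (inW w) + 𝟙 (inZ w))
      ≤⟨ ∑-mono-≤ (λ w → X∪W∪Z⊆R∖Y (adj G u w) (adj G v w) (w == u) (w == v) (no-loop u w) (no-loop v w)) ⟩
    ∑[ w < n ] 𝟙 (R∖Y w) ∎
    where
    open ≤-Reasoning
    inX inW inZ : Fin n → Bool
    inX w = adj G u w ∧ not (adj G v w) ∧ not (w == v)
    inW w = adj G u w ∧ adj G v w
    inZ w = not (w == u) ∧ not (w == v)
            ∧ not (adj G u w ∧ not (adj G v w) ∧ not (w == v))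
            ∧ not (adj G v w ∧ not (adj G u w) ∧ not (w == u))
            ∧ not (adj G u w ∧ adj G v w)
    no-loop : ∀ x w → (w == x) ≡ true → adj G x w ≡ false
    no-loop x w w==x = trans (cong (adj G x) (==⇒≡ w==x)) (irrefl G x)

  R∖Y-avoids-u : R∖Y u ≡ false
  R∖Y-avoids-u rewrite ==-refl u = refl

  R∖Y-avoids-v : R∖Y v ≡ false
  R∖Y-avoids-v rewrite ==-refl v = Bool.∧-zeroʳ (not (v == u))

  R∖Y⇒adj : ∀ w → R∖Y w ≡ true → adj G v w ≡ true → adj G u w ≡ true
  R∖Y⇒adj w w∈R∖Y v~w
    with _ , w∈R∖Y ← ∧-split {not (w == u)} w∈R∖Y
    with _ , w∉Y ← ∧-split {not (w == v)} w∈R∖Y =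
    trans (sym (Bool.not-involutive (adj G u w))) (subst (λ b → not (b ∧ not (adj G u w)) ≡ true) v~w w∉Y)

  degIn-v≤degIn-u : ∀ S → (∀ i → lookup S i ≡ true → R∖Y i ≡ true) → degIn G S v ≤ degIn G S u
  degIn-v≤degIn-u S S⊆R∖Y = ∑-mono-≤ pointwise
    where
    pointwise : ∀ i → 𝟙 (lookup S i ∧ adj G v i) ≤ 𝟙 (lookup S i ∧ adj G u i)
    pointwise i with lookup S i in i∈S | adj G v i in v~i
    ... | false | _     = z≤n
    ... | true  | false = z≤n
    ... | true  | true rewrite R∖Y⇒adj i (S⊆R∖Y i i∈S) v~i = s≤s z≤n

lemma2 : ∀ {n : ℕ} (G : Graph n) (u v : Fin n) (k : ℕ) →
    ¬ IsRegular G →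
    deg G u < deg G v →
    2 ≤ k → k ≤ n ∸ 2 →
    k ∸ 1 ≤ sizeX G u v + sizeW G u v + sizeZ G u v →
    ¬ TokenRegular G k
lemma2 G u v (suc k) _ deg-u<deg-v (s≤s _) _ k≤|X|+|W|+|Z| (r , F-regular)
  with S , card-S , S⊆R∖Y ← choose-subset (R∖Y G u v) k (≤-trans k≤|X|+|W|+|Z| (|X|+|W|+|Z|≤|R∖Y| G u v)) =
  <-irrefl (trans (∂≡r u u∉S) (sym (∂≡r v v∉S)))
           (∂-insert-< G S u∉S v∉S (degIn-v≤degIn-u G u v S S⊆R∖Y) deg-u<deg-v)
  where
  u∉S : lookup S u ≡ false
  u∉S = ⊆-∉ S S⊆R∖Y u (R∖Y-avoids-u G u v)
  v∉S : lookup S v ≡ false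
  v∉S = ⊆-∉ S S⊆R∖Y v (R∖Y-avoids-v G u v)
  ∂≡r : ∀ w → lookup S w ≡ false → ∂ G (insert S w) ≡ r
  ∂≡r w w∉S = trans (sym (tokenDeg≡∂ G (insert S w) card-S∪w)) (F-regular (insert S w) card-S∪w)
    where
    card-S∪w : card (insert S w) ≡ suc k
    card-S∪w = trans (card-insert S w∉S) (cong suc card-S)
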